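{- Let $S$ be a finite $G$-set with orbit set $\mathcal{O}=\mathcal{O}(S)=\{o_1,\dots,o_k\}$. Define $\pi_n:\mathcal{D}_n(G,S)\to\Pi_n(\mathcal{O})$ by sending $(\tilde\beta,z)$, with $\beta=\{B_1,\dots,B_\ell\}$ ordered so that $|B_1|\geq\cdots\geq|B_\ell|$, to the $\mathcal{O}$-labeled partition $(|B_1|,\dots,|B_\ell|\,\|\,|z^{ -1}(o_1)|_{o_1},\dots,|z^{ -1}(o_k)|_{o_k})$. Then $\pi_n$ is surjective and its fibers are exactly the $\Sigma_n[G]$-orbits of $\mathcal{D}_n(G,S)$; hence the $\Sigma_n[G]$-orbits of $\mathcal{D}_n(G,S)$ are in bijection with the $\mathcal{O}$-labeled partitions of $n$.
   Context: $G$ is a finite group acting on a finite set $S$, $n\geq1$. A projectivized $G$-coloring of a finite set $B$ is an equivalence class of functions $b:B\to G$ with $b\sim bg$ for $g\in G$. A partial $G$-partition $\tilde\beta$ of $[n]$ is a partition $\beta$ of a subset of $[n]$ into nonempty blocks each with a projectivized $G$-coloring; its zero block is $Z=[n]\setminus\bigcup_{B\in\beta}B$. $\mathcal{D}_n(G,S)$ is the set of pairs $(\tilde\beta,z)$ with $z:Z\to S$. The wreath product $\Sigma_n[G]=G^n\rtimes\Sigma_n$ acts: $(g_1,\dots,g_n,\sigma)$ sends $(\tilde\beta,z)$ to the pair with blocks $\sigma(B)$ colored by $b'(\sigma(j))=g_jb(j)$ and zero block $\sigma(Z)$ colored by $z'(\sigma(j))=g_j.z(j)$. An $\mathcal{O}$-labeled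 partition of $n$ is a tuple $(\lambda_1,\dots,\lambda_\ell\,\|\,\lambda_{o_1},\dots,\lambda_{o_k})$ of integers with $\lambda_1\geq\cdots\geq\lambda_\ell>0$ (unlabeled parts), $\lambda_{o_j}\geq0$ (labeled parts, each label used once) and $\sum\lambda_i+\sum\lambda_{o_j}=n$; $\Pi_n(\mathcal{O})$ denotes the set of these. -}

module Defs where

open import Data.Nat using (ℕ; zero; suc; _+_; _≤_; _<_; _≥_)
open import Data.Nat.Properties using (≤-decTotalOrder)
open import Data.Fin using (Fin)
open import Data.Fin.Properties using () renaming (_≟_ to _≟F_)
open import Data.Fin.Permutation using (Permutation′; _⟨$⟩ˡ_)
open import Data.List using (List; []; _∷_; map; filter; length; reverse; allFin)
open import Data.Nat.ListAction using (sum)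
open import Data.List.Relation.Unary.All using (All)
open import Data.List.Relation.Unary.Linked using (Linked)
open import Data.Maybe using (Maybe; just; nothing)
open import Data.Product using (Σ; _×_; _,_; ∃)
open import Data.Sum using (_⊎_; inj₁; inj₂)
open import Data.Bool using (Bool; true; false)
open import Relation.Nullary using (¬_; does)
open import Relation.Binary.PropositionalEquality using (_≡_)
open import Algebra.Structures using (IsGroup)
import Data.List.Sort as Sort

-- Finite groups and finite G-sets.
-- A finite group is modelled (up to isomorphism) as a group structure on
-- Fin m with propositional equality; a finite G-set as Fin s with an action.

record FinGroup : Set where
  field
    order   : ℕ
    _∙_     : Fin order → Fin order → Fin order
    ε       : Fin order
    _⁻¹     : Fin order → Fin order
    isGroup : IsGroup _≡_ _∙_ ε _⁻¹
  Carrier : Set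
  Carrier = Fin order

record FinGSet (G : FinGroup) : Set where
  open FinGroup G
  field
    size  : ℕ
    act   : Carrier → Fin size → Fin size
    act-ε : ∀ x → act ε x ≡ x
    act-∙ : ∀ g h x → act (g ∙ h) x ≡ act g (act h x)
  Point : Set
  Point = Fin size

record OrbitEnumeration {G : FinGroup} (S : FinGSet G) (k : ℕ) : Set where
  open FinGroup G
  open FinGSet S
  field
    orb     : Point → Fin k
    orb-sur : ∀ i → ∃ λ x → orb x ≡ i
    orb-sound    : ∀ x y → orb x ≡ orb y → ∃ λ g → act g x ≡ y
    orb-complete : ∀ x y g → act g x ≡ y → orb x ≡ orb y

-- A raw datum d : Fin n → Entry assigns to each j ∈ [n] either
--   inj₁ (l , c) : j lies in the block with label l and has colour c ∈ G, or
--   inj₂ x       : j lies in the zero block Z and z(j) = x ∈ S.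
-- Blocks are the (automatically nonempty) fibres of the labels; the labels
-- themselves carry no meaning. D_n(G,S) is the quotient of raw data by _≈D_
-- below (relabelling blocks, and b ∼ b g on each block).

module _ (G : FinGroup) (S : FinGSet G) where
  open FinGroup G
  open FinGSet S

  Entry : ℕ → Set
  Entry n = (Fin n × Carrier) ⊎ Point

  Raw : ℕ → Set
  Raw n = Fin n → Entry n

  blockOf : ∀ {n} → Entry n → Maybe (Fin n)
  blockOf (inj₁ (l , _)) = just l
  blockOf (inj₂ _)       = nothing

  colourOf : ∀ {n} → Entry n → Carrier
  colourOf (inj₁ (_ , c)) = c
  colourOf (inj₂ _)       = ε

  zeroOf : ∀ {n} → Entry n → Maybe Point
  zeroOf (inj₁ _) = nothing
  zeroOf (inj₂ x) = just x

  SameBlock : ∀ {n} → Raw n → Fin n → Fin n → Set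
  SameBlock d i j = Σ _ λ l → blockOf (d i) ≡ just l × blockOf (d j) ≡ just l

  record _≈D_ {n} (d d′ : Raw n) : Set where
    field
      sameZero   : ∀ j → zeroOf (d j) ≡ zeroOf (d′ j)
      sameBlocks : ∀ i j → (SameBlock d i j → SameBlock d′ i j)
                         × (SameBlock d′ i j → SameBlock d i j)
      sameColour : ∀ i j → SameBlock d i j →
                   ((colourOf (d i)) ⁻¹) ∙ colourOf (d′ i)
                     ≡ ((colourOf (d j)) ⁻¹) ∙ colourOf (d′ j)

  record Wreath (n : ℕ) : Set where
    constructor wr
    field
      gs : Fin n → Carrier
      σ  : Permutation′ n

  actEntry : ∀ {n} → Carrier → Entry n → Entry n
  actEntry g (inj₁ (l , c)) = inj₁ (l , g ∙ c)
  actEntry g (inj₂ x)       = inj₂ (act g x)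

  actW : ∀ {n} → Wreath n → Raw n → Raw n
  actW (wr gs σ) d k = actEntry (gs (σ ⟨$⟩ˡ k)) (d (σ ⟨$⟩ˡ k))

count : ∀ {n} → (Fin n → Bool) → ℕ
count {n} p = length (filter (λ j → p j Data.Bool.≟ true) (allFin n))

LPRaw : ℕ → Set
LPRaw k = List ℕ × (Fin k → ℕ)

IsLabeledPartition : (n k : ℕ) → LPRaw k → Set
IsLabeledPartition n k (parts , lab) =
  Linked _≥_ parts × All (λ p → 0 < p) parts
  × sum parts + sum (map lab (allFin k)) ≡ n

_≈LP_ : ∀ {k} → LPRaw k → LPRaw k → Set
(ps , f) ≈LP (qs , g) = ps ≡ qs × (∀ i → f i ≡ g i)

sortDesc : List ℕ → List ℕ
sortDesc xs = reverse (Sort.sort ≤-decTotalOrder xs)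

module _ (G : FinGroup) (S : FinGSet G) {k : ℕ} (O : OrbitEnumeration S k) where
  open OrbitEnumeration O

  inBlock : ∀ {n} → Fin n → Entry G S n → Bool
  inBlock l (inj₁ (l′ , _)) = does (l ≟F l′)
  inBlock l (inj₂ _)        = false

  inOrbit : ∀ {n} → Fin k → Entry G S n → Bool
  inOrbit i (inj₁ _) = false
  inOrbit i (inj₂ x) = does (orb x ≟F i)

  -- |B_l| for the block with label l (0 if the label is unused)
  blockSize : ∀ {n} → Raw G S n → Fin n → ℕ
  blockSize d l = count (λ j → inBlock l (d j))

  nonzero : ℕ → Bool
  nonzero zero    = false
  nonzero (suc _) = true

  πn : ∀ {n} → Raw G S n → LPRaw k
  πn {n} d =
    ( sortDesc (filter (λ m → nonzero m Data.Bool.≟ true) (map (blockSize d) (allFin n)))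
    , (λ i → count (λ j → inOrbit i (d j))) )

module Submission where

-- Everything reduces to counting over Fin n.  The block sizes of d enter πn d only
-- through their shape (the nonzero values sorted decreasingly), and the shape of
-- f : Fin n → ℕ determines, and is determined by, the sizes of the fibres of f.
--  · πn lands in Π_n(O): each point lies in exactly one block or over exactly one
--    orbit, so block sizes and orbit sizes add up to n.
--  · πn is well defined: double counting gives m · #{blocks of size m} =
--    #{points whose block has size m}, and the right side only depends on the class.
--  · πn is surjective: realise the prescribed multiplicities by a map Fin n → Fin (n + k).
--  · πn is Σₙ[G]-invariant: the action permutes points and moves colours and points
--    within their orbits.
--  · fibres are orbits: maps Fin n → A with fibres of equal sizes differ by a
--    permutation; applied to block sizes this relabels the blocks, applied to the
--    "keys" of points (block label or orbit) it matches the points, and each matched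
--    pair of points is related by one group element.

open import Defs
open import Data.Nat using (ℕ; zero; suc; _+_; _∸_; _*_; _≤_; _<_; _≥_; s≤s; z≤n; _≟_)
open import Data.Nat.Properties
open import Data.Nat.ListAction using (sum)
open import Data.Nat.ListAction.Properties using (sum-↭)
open import Data.Bool using (Bool; true; false)
import Data.Bool as Bool
open import Data.Bool.Properties using (⇔→≡)
open import Data.Fin using (Fin; zero; suc; punchIn; splitAt)
import Data.Fin as Fin
open import Data.Fin.Permutation using (Permutation′; _⟨$⟩ʳ_; _⟨$⟩ˡ_; flip; insert; insert-punchIn)
import Data.Fin.Permutation as Perm
open import Data.List using (List; []; _∷_; _++_; map; filter; length; allFin; tabulate; reverse; foldl; replicate)
open import Data.List.Properties using (map-tabulate; map-cong; map-∘; reverse-involutive; length-map; length-tabulate)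
open import Data.List.Relation.Unary.All using (All; []; _∷_)
open import Data.List.Relation.Unary.Any using (here; there)
open import Data.List.Relation.Unary.Linked using (Linked; []; [-]; _∷_)
open import Data.List.Relation.Unary.Sorted.TotalOrder.Properties using (↗↭↗⇒≋)
open import Data.List.Relation.Binary.Pointwise using (Pointwise-≡⇒≡)
open import Data.List.Relation.Binary.Permutation.Propositional using (_↭_; ↭-refl; ↭-prep; ↭-trans; ↭-sym; ↭⇒↭ₛ′)
open import Data.List.Relation.Binary.Permutation.Propositional.Properties
  using (map⁺; shift; ↭-reverse; ↭-length; All-resp-↭)
open import Data.List.Membership.Propositional using (_∈_)
open import Data.List.Membership.Propositional.Properties using (∈-∃++)
import Data.List.Sort as Sort
open import Data.Maybe using (just)
open import Data.Maybe.Properties using (just-injective)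
open import Data.Product using (Σ; _×_; _,_; ∃; proj₁; proj₂)
open import Data.Sum using (_⊎_; inj₁; inj₂)
import Data.Sum as Sum
open import Data.Sum.Properties using (≡-dec; inj₁-injective; inj₂-injective)
open import Function using (_∘_; id) renaming (flip to flip′)
open import Function.Bundles using (_⇔_; mk⇔; Equivalence)
open import Function.Properties.Equivalence using () renaming (trans to ⇔-trans; sym to ⇔-sym)
open import Relation.Nullary using (Dec; does; yes; no)
open import Relation.Nullary.Decidable using (dec-true; dec-false; does-⇔)
open import Relation.Binary using (DecidableEquality)
open import Relation.Binary.PropositionalEquality
open import Algebra.Structures using (IsGroup)
open import Algebra.Properties.Semiring.Sum +-*-semiring
  using (∑-distrib-+; ∑-comm; sum-permute; sum-remove; sum-cong-≗; *-distribˡ-sum) renaming (sum to ∑)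

𝟙 : Bool → ℕ
𝟙 true  = 1
𝟙 false = 0

∑-const : ∀ n x → ∑ {n} (λ _ → x) ≡ n * x
∑-const zero    x = refl
∑-const (suc n) x = cong (x +_) (∑-const n x)

∑-vanishing : ∀ {n} (h : Fin n → ℕ) → (∀ l → h l ≡ 0) → ∑ h ≡ 0
∑-vanishing {zero}  h h≡0 = refl
∑-vanishing {suc n} h h≡0 = cong₂ _+_ (h≡0 zero) (∑-vanishing (h ∘ suc) (h≡0 ∘ suc))

∑-splitAt : ∀ m {n} (u : Fin m ⊎ Fin n → ℕ) → ∑ (u ∘ splitAt m) ≡ ∑ (u ∘ inj₁) + ∑ (u ∘ inj₂)
∑-splitAt zero    u = refl
∑-splitAt (suc m) u = trans (cong (u (inj₁ zero) +_) (∑-splitAt m (u ∘ Sum.map₁ suc)))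
                            (sym (+-assoc (u (inj₁ zero)) _ _))

δ : ∀ {n} → Fin n → Fin n → ℕ
δ a b = 𝟙 (does (a Fin.≟ b))

δ-sym : ∀ {n} (a b : Fin n) → δ a b ≡ δ b a
δ-sym a b = cong 𝟙 (does-⇔ (mk⇔ sym sym) (a Fin.≟ b) (b Fin.≟ a))

∑-δ : ∀ {n} (l₀ : Fin n) (h : Fin n → ℕ) → ∑ (λ l → h l * δ l l₀) ≡ h l₀
∑-δ {suc n} zero     h = trans (cong₂ _+_ (*-identityʳ (h zero)) (∑-vanishing _ (λ l → *-zeroʳ (h (suc l)))))
                               (+-identityʳ (h zero))
∑-δ {suc n} (suc l₀) h = trans (cong (_+ ∑ (λ l → h (suc l) * δ l l₀)) (*-zeroʳ (h zero))) (∑-δ l₀ (h ∘ suc))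

∑-δ-single : ∀ {n} (l₀ : Fin n) → ∑ (λ l → δ l l₀) ≡ 1
∑-δ-single l₀ = trans (sum-cong-≗ (λ l → sym (*-identityˡ (δ l l₀)))) (∑-δ l₀ (λ _ → 1))

#_ : ∀ {n} → (Fin n → Bool) → ℕ
# p = ∑ (𝟙 ∘ p)

sum-allFin : ∀ {n} (f : Fin n → ℕ) → sum (map f (allFin n)) ≡ ∑ f
sum-allFin f = trans (cong sum (map-tabulate id f)) (sum-tabulate f)
  where
  sum-tabulate : ∀ {n} (g : Fin n → ℕ) → sum (tabulate g) ≡ ∑ g
  sum-tabulate {zero}  g = refl
  sum-tabulate {suc n} g = cong (g zero +_) (sum-tabulate (g ∘ suc))

length-filter : ∀ {A : Set} (p : A → Bool) xs →
                length (filter (λ x → p x Bool.≟ true) xs) ≡ sum (map (𝟙 ∘ p) xs)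
length-filter p []       = refl
length-filter p (x ∷ xs) with p x
... | true  = cong suc (length-filter p xs)
... | false = length-filter p xs

count≡# : ∀ {n} (p : Fin n → Bool) → count p ≡ # p
count≡# p = trans (length-filter p (allFin _)) (sum-allFin (𝟙 ∘ p))

count-cong : ∀ {n} {p q : Fin n → Bool} → (∀ j → p j ≡ q j) → count p ≡ count q
count-cong {p = p} {q} p≗q = trans (count≡# p) (trans (sum-cong-≗ (cong 𝟙 ∘ p≗q)) (sym (count≡# q)))

#-permute : ∀ {n} (σ : Permutation′ n) (p : Fin n → Bool) → # (p ∘ (σ ⟨$⟩ˡ_)) ≡ # p
#-permute σ p = sym (sum-permute (𝟙 ∘ p) (flip σ))

#-witness : ∀ {n} (p : Fin n → Bool) → 1 ≤ # p → ∃ λ j → p j ≡ true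
#-witness {suc n} p pos with p zero in eq
... | true  = zero , eq
... | false = let j , pj = #-witness (p ∘ suc) pos in suc j , pj

witness : ∀ {P : Set} (p? : Dec P) → does p? ≡ true → P
witness (yes p) _  = p
witness (no _)  ()

module Fibres {A : Set} (_≟_ : DecidableEquality A) where

  fibre : ∀ {n} → (Fin n → A) → A → ℕ
  fibre f a = # (λ j → does (f j ≟ a))

  -- Two maps Fin n → A whose fibres have equal sizes differ by a permutation
  -- of Fin n: send 0 to a point of g's fibre over f 0 and recurse on the rest.
  matching : ∀ {n} (f g : Fin n → A) → (∀ a → fibre f a ≡ fibre g a) →
             Σ (Permutation′ n) λ σ → ∀ j → g (σ ⟨$⟩ʳ j) ≡ f j
  matching {zero}  f g _    = Perm.id , λ ()
  matching {suc n} f g same = insert zero j (proj₁ rec) , match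
    where
    a = f zero
    a∈f : 1 ≤ fibre f a
    a∈f rewrite dec-true (a ≟ a) refl = s≤s z≤n
    hit = #-witness (λ i → does (g i ≟ a)) (subst (1 ≤_) (same a) a∈f)
    j = proj₁ hit
    gj≡a : g j ≡ a
    gj≡a = witness (g j ≟ a) (proj₂ hit)
    rest : ∀ b → fibre (f ∘ suc) b ≡ fibre (g ∘ punchIn j) b
    rest b = +-cancelˡ-≡ (𝟙 (does (a ≟ b))) _ _ (begin
      𝟙 (does (a ≟ b)) + fibre (f ∘ suc) b
        ≡⟨ same b ⟩
      fibre g b
        ≡⟨ sum-remove {i = j} (λ i → 𝟙 (does (g i ≟ b))) ⟩
      𝟙 (does (g j ≟ b)) + fibre (g ∘ punchIn j) b
        ≡⟨ cong (λ x → 𝟙 (does (x ≟ b)) + fibre (g ∘ punchIn j) b) gj≡a ⟩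
      𝟙 (does (a ≟ b)) + fibre (g ∘ punchIn j) b ∎)
      where open ≡-Reasoning
    rec = matching (f ∘ suc) (g ∘ punchIn j) rest
    match : ∀ i → g (insert zero j (proj₁ rec) ⟨$⟩ʳ i) ≡ f i
    match zero    = gj≡a
    match (suc i) = trans (cong g (insert-punchIn zero j (proj₁ rec) i)) (proj₂ rec i)

open Fibres _≟_ using (fibre) renaming (matching to matching-ℕ)

-- Double counting: for subsets M l ⊆ Fin n (given by membership mem l), m times
-- the number of subsets of size m is the total membership in subsets of size m.
double-count : ∀ {L n} (mem : Fin L → Fin n → Bool) m →
  m * fibre (λ l → count (mem l)) m ≡ ∑ (λ j → ∑ (λ l → 𝟙 (does (count (mem l) ≟ m)) * 𝟙 (mem l j)))
double-count mem m = begin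
  m * ∑ E                                  ≡⟨ *-distribˡ-sum m E ⟩
  ∑ (λ l → m * E l)                        ≡⟨ sum-cong-≗ (λ l → scale (count (mem l))) ⟩
  ∑ (λ l → E l * count (mem l))            ≡⟨ sum-cong-≗ (λ l → cong (E l *_) (count≡# (mem l))) ⟩
  ∑ (λ l → E l * # (mem l))                ≡⟨ sum-cong-≗ (λ l → *-distribˡ-sum (E l) (𝟙 ∘ mem l)) ⟩
  ∑ (λ l → ∑ (λ j → E l * 𝟙 (mem l j)))    ≡⟨ ∑-comm (λ l j → E l * 𝟙 (mem l j)) ⟩
  ∑ (λ j → ∑ (λ l → E l * 𝟙 (mem l j)))    ∎
  where
  open ≡-Reasoning
  E = λ l → 𝟙 (does (count (mem l) ≟ m))
  scale : ∀ s → m * 𝟙 (does (s ≟ m)) ≡ 𝟙 (does (s ≟ m)) * s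
  scale s with s ≟ m
  ... | yes refl rewrite dec-true (s ≟ s) refl = *-comm s 1
  ... | no  s≢m  rewrite dec-false (s ≟ m) s≢m = *-zeroʳ m

-- h : Fin N → Fin K realises the multiplicities c when every v has exactly
-- c v preimages; in weighted form, ∑ⱼ w (h j) = ∑ᵥ c v · w v for every weight w.
Realises : ∀ {N K} → (Fin N → Fin K) → (Fin K → ℕ) → Set
Realises h c = ∀ w → ∑ (w ∘ h) ≡ ∑ (λ v → c v * w v)

-- Multiplicities c with total N are realised by some h : Fin N → Fin K:
-- send the first c 0 points to 0 and realise the remaining ones recursively.
realise : ∀ {K} (c : Fin K → ℕ) {N} → ∑ c ≡ N → Σ (Fin N → Fin K) λ h → Realises h c
realise {zero}  c refl = (λ ()) , λ w → refl
realise {suc K} c refl = place ∘ splitAt (c zero) , realises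
  where
  rest = realise (c ∘ suc) refl
  place : Fin (c zero) ⊎ Fin (∑ (c ∘ suc)) → Fin (suc K)
  place = Sum.[ (λ _ → zero) , suc ∘ proj₁ rest ]′
  realises : Realises (place ∘ splitAt (c zero)) c
  realises w = begin
    ∑ (w ∘ place ∘ splitAt (c zero))                       ≡⟨ ∑-splitAt (c zero) (w ∘ place) ⟩
    ∑ {c zero} (λ _ → w zero) + ∑ (w ∘ suc ∘ proj₁ rest)
      ≡⟨ cong₂ _+_ (∑-const (c zero) (w zero)) (proj₂ rest (w ∘ suc)) ⟩
    c zero * w zero + ∑ (λ v → c (suc v) * w (suc v))      ∎
    where open ≡-Reasoning

occ : ℕ → List ℕ → ℕ
occ m xs = sum (map (λ x → 𝟙 (does (x ≟ m))) xs)

occ-↭ : ∀ m {xs ys} → xs ↭ ys → occ m xs ≡ occ m ys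
occ-↭ m p = sum-↭ (map⁺ _ p)

occ-head : ∀ x xs → 1 ≤ occ x (x ∷ xs)
occ-head x xs rewrite dec-true (x ≟ x) refl = s≤s z≤n

occ-∈ : ∀ {m} xs → 1 ≤ occ m xs → m ∈ xs
occ-∈ {m} (x ∷ xs) pos with x ≟ m
... | yes refl = here refl
... | no  x≢m rewrite dec-false (x ≟ m) x≢m = there (occ-∈ xs pos)

occ⇒↭ : ∀ xs ys → (∀ m → occ m xs ≡ occ m ys) → xs ↭ ys
occ⇒↭ []       []       _    = ↭-refl
occ⇒↭ []       (y ∷ ys) same with () ← subst (1 ≤_) (sym (same y)) (occ-head y ys)
occ⇒↭ (x ∷ xs) ys       same with ∈-∃++ (occ-∈ ys (subst (1 ≤_) (same x) (occ-head x xs)))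
... | as , bs , refl = ↭-trans (↭-prep x (occ⇒↭ xs (as ++ bs) rest)) (↭-sym (shift x as bs))
  where
  rest : ∀ m → occ m xs ≡ occ m (as ++ bs)
  rest m = +-cancelˡ-≡ (𝟙 (does (x ≟ m))) _ _ (trans (same m) (occ-↭ m (shift x as bs)))

occ-allFin : ∀ {n} m (f : Fin n → ℕ) → occ m (map f (allFin n)) ≡ fibre f m
occ-allFin m f = trans (cong sum (sym (map-∘ {g = λ x → 𝟙 (does (x ≟ m))} {f = f} (allFin _))))
                       (sum-allFin (λ j → 𝟙 (does (f j ≟ m))))

reverse-linked : ∀ {A : Set} {R : A → A → Set} xs → Linked R xs → Linked (flip′ R) (reverse xs)
reverse-linked []       _      = []
reverse-linked (x ∷ xs) linked = go x xs [] linked [-]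
  where
  -- reverse = foldl (flip _∷_) [], so carry the already reversed prefix
  go : ∀ {A : Set} {R : A → A → Set} x xs acc → Linked R (x ∷ xs) → Linked (flip′ R) (x ∷ acc) →
       Linked (flip′ R) (foldl (flip′ _∷_) (x ∷ acc) xs)
  go x []       acc _          done = done
  go x (y ∷ ys) acc (r ∷ rest) done = go y ys (x ∷ acc) rest (r ∷ done)

module Sorting = Sort ≤-decTotalOrder

sorted-unique : ∀ {xs ys} → Linked _≤_ xs → Linked _≤_ ys → xs ↭ ys → xs ≡ ys
sorted-unique xs↗ ys↗ xs↭ys =
  Pointwise-≡⇒≡ (↗↭↗⇒≋ ≤-totalOrder xs↗ ys↗ (↭⇒↭ₛ′ isEquivalence xs↭ys))

sortDesc-↭ : ∀ xs → sortDesc xs ↭ xs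
sortDesc-↭ xs = ↭-trans (↭-reverse _) (Sorting.sort-↭ xs)

sortDesc-descending : ∀ xs → Linked _≥_ (sortDesc xs)
sortDesc-descending xs = reverse-linked _ (Sorting.sort-↗ xs)

sortDesc-cong : ∀ {xs ys} → xs ↭ ys → sortDesc xs ≡ sortDesc ys
sortDesc-cong {xs} {ys} xs↭ys = cong reverse (sorted-unique (Sorting.sort-↗ xs) (Sorting.sort-↗ ys)
  (↭-trans (Sorting.sort-↭ xs) (↭-trans xs↭ys (↭-sym (Sorting.sort-↭ ys)))))

sortDesc-id : ∀ xs → Linked _≥_ xs → sortDesc xs ≡ xs
sortDesc-id xs xs↘ = trans (cong reverse sort≡reverse) (reverse-involutive xs)
  where
  sort≡reverse : Sorting.sort xs ≡ reverse xs
  sort≡reverse = sorted-unique (Sorting.sort-↗ xs) (reverse-linked xs xs↘)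
    (↭-trans (Sorting.sort-↭ xs) (↭-sym (↭-reverse xs)))

listSizes : ∀ {n} → List ℕ → Fin n → ℕ
listSizes []       _       = 0
listSizes (p ∷ ps) zero    = p
listSizes (p ∷ ps) (suc l) = listSizes ps l

tabulate-listSizes : ∀ n ps → length ps ≤ n → tabulate {n = n} (listSizes ps) ≡ ps ++ replicate (n ∸ length ps) 0
tabulate-listSizes zero    []       _          = refl
tabulate-listSizes (suc n) []       _          = cong (0 ∷_) (tabulate-listSizes n [] z≤n)
tabulate-listSizes (suc n) (p ∷ ps) (s≤s fits) = cong (p ∷_) (tabulate-listSizes n ps fits)

length≤sum : ∀ ps → All (0 <_) ps → length ps ≤ sum ps
length≤sum []           []        = z≤n
length≤sum (suc p ∷ ps) (_ ∷ ps⁺) = s≤s (≤-trans (length≤sum ps ps⁺) (m≤n+m (sum ps) p))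

module _ (G : FinGroup) (S : FinGSet G) {k : ℕ} (O : OrbitEnumeration S k) where
  open FinGroup G
  open FinGSet S
  open OrbitEnumeration O

  -- The filter used by πn (Defs defines nonzero inside a module parametrised by G, S, O).
  nonzeros : List ℕ → List ℕ
  nonzeros = filter (λ m → nonzero G S O m Bool.≟ true)

  occ-nonzeros : ∀ m xs → occ (suc m) (nonzeros xs) ≡ occ (suc m) xs
  occ-nonzeros m []           = refl
  occ-nonzeros m (zero  ∷ xs) = occ-nonzeros m xs
  occ-nonzeros m (suc x ∷ xs) = cong (𝟙 (does (suc x ≟ suc m)) +_) (occ-nonzeros m xs)

  occ₀-nonzeros : ∀ xs → occ 0 (nonzeros xs) ≡ 0
  occ₀-nonzeros []           = refl
  occ₀-nonzeros (zero  ∷ xs) = occ₀-nonzeros xs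
  occ₀-nonzeros (suc x ∷ xs) = occ₀-nonzeros xs

  length-nonzeros : ∀ xs → length (nonzeros xs) + occ 0 xs ≡ length xs
  length-nonzeros []           = refl
  length-nonzeros (zero  ∷ xs) = trans (+-suc _ _) (cong suc (length-nonzeros xs))
  length-nonzeros (suc x ∷ xs) = cong suc (length-nonzeros xs)

  nonzeros-positive : ∀ xs → All (0 <_) (nonzeros xs)
  nonzeros-positive []           = []
  nonzeros-positive (zero  ∷ xs) = nonzeros-positive xs
  nonzeros-positive (suc x ∷ xs) = s≤s z≤n ∷ nonzeros-positive xs

  sum-nonzeros : ∀ xs → sum (nonzeros xs) ≡ sum xs
  sum-nonzeros []           = refl
  sum-nonzeros (zero  ∷ xs) = sum-nonzeros xs
  sum-nonzeros (suc x ∷ xs) = cong (suc x +_) (sum-nonzeros xs)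

  nonzeros-padded : ∀ ps r → All (0 <_) ps → nonzeros (ps ++ replicate r 0) ≡ ps
  nonzeros-padded []           zero    []        = refl
  nonzeros-padded []           (suc r) []        = nonzeros-padded [] r []
  nonzeros-padded (suc p ∷ ps) r       (_ ∷ ps⁺) = cong (suc p ∷_) (nonzeros-padded ps r ps⁺)

  shape : ∀ {n} → (Fin n → ℕ) → List ℕ
  shape f = sortDesc (nonzeros (map f (allFin _)))

  shape-cong : ∀ {n} {f g : Fin n → ℕ} → (∀ m → fibre f (suc m) ≡ fibre g (suc m)) → shape f ≡ shape g
  shape-cong {n} {f} {g} same = sortDesc-cong (occ⇒↭ _ _ multiplicity)
    where
    multiplicity : ∀ m → occ m (nonzeros (map f (allFin n))) ≡ occ m (nonzeros (map g (allFin n)))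
    multiplicity zero    = trans (occ₀-nonzeros (map f (allFin n))) (sym (occ₀-nonzeros (map g (allFin n))))
    multiplicity (suc m) = begin
      occ (suc m) (nonzeros (map f (allFin n))) ≡⟨ occ-nonzeros m (map f (allFin n)) ⟩
      occ (suc m) (map f (allFin n))            ≡⟨ occ-allFin (suc m) f ⟩
      fibre f (suc m)                           ≡⟨ same m ⟩
      fibre g (suc m)                           ≡⟨ occ-allFin (suc m) g ⟨
      occ (suc m) (map g (allFin n))            ≡⟨ occ-nonzeros m (map g (allFin n)) ⟨
      occ (suc m) (nonzeros (map g (allFin n))) ∎
      where open ≡-Reasoning

  shape-fibres : ∀ {n} {f g : Fin n → ℕ} → shape f ≡ shape g → ∀ m → fibre f m ≡ fibre g m
  shape-fibres {n} {f} {g} same-shape = same-fibre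
    where
    Lf = nonzeros (map f (allFin n))
    Lg = nonzeros (map g (allFin n))
    Lf↭Lg : Lf ↭ Lg
    Lf↭Lg = ↭-trans (↭-sym (sortDesc-↭ Lf)) (subst (_↭ Lg) (sym same-shape) (sortDesc-↭ Lg))
    complement : ∀ (h : Fin n → ℕ) → length (nonzeros (map h (allFin n))) + fibre h 0 ≡ n
    complement h = begin
      length (nonzeros (map h (allFin n))) + fibre h 0
        ≡⟨ cong (length (nonzeros (map h (allFin n))) +_) (occ-allFin 0 h) ⟨
      length (nonzeros (map h (allFin n))) + occ 0 (map h (allFin n))
        ≡⟨ length-nonzeros (map h (allFin n)) ⟩
      length (map h (allFin n))
        ≡⟨ length-map h (allFin n) ⟩
      length (allFin n)
        ≡⟨ length-tabulate id ⟩
      n ∎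
      where open ≡-Reasoning
    same-fibre : ∀ m → fibre f m ≡ fibre g m
    same-fibre zero    = +-cancelˡ-≡ (length Lf) _ _
      (trans (complement f) (trans (sym (complement g)) (cong (_+ fibre g 0) (sym (↭-length Lf↭Lg)))))
    same-fibre (suc m) = begin
      fibre f (suc m)                ≡⟨ occ-allFin (suc m) f ⟨
      occ (suc m) (map f (allFin n)) ≡⟨ occ-nonzeros m (map f (allFin n)) ⟨
      occ (suc m) Lf                 ≡⟨ occ-↭ (suc m) Lf↭Lg ⟩
      occ (suc m) Lg                 ≡⟨ occ-nonzeros m (map g (allFin n)) ⟩
      occ (suc m) (map g (allFin n)) ≡⟨ occ-allFin (suc m) g ⟩
      fibre g (suc m)                ∎
      where open ≡-Reasoning

  orbitSize : ∀ {n} → Raw G S n → Fin k → ℕ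
  orbitSize d i = count (λ j → inOrbit G S O i (d j))

  one-class : ∀ {n} (e : Entry G S n) →
              ∑ (λ l → 𝟙 (inBlock G S O l e)) + ∑ (λ i → 𝟙 (inOrbit G S O i e)) ≡ 1
  one-class e@(inj₁ (l₀ , _)) = cong₂ _+_ (∑-δ-single l₀) (∑-vanishing (λ i → 𝟙 (inOrbit G S O i e)) (λ _ → refl))
  one-class e@(inj₂ x)        = trans (cong₂ _+_ (∑-vanishing (λ l → 𝟙 (inBlock G S O l e)) (λ _ → refl))
                                                 (sum-cong-≗ (λ i → δ-sym (orb x) i)))
                                      (∑-δ-single (orb x))

  total-size : ∀ {n} (d : Raw G S n) → ∑ (blockSize G S O d) + ∑ (orbitSize d) ≡ n
  total-size {n} d = begin
    ∑ (blockSize G S O d) + ∑ (orbitSize d)                ≡⟨ cong₂ _+_ (sum-cong-≗ (λ l → count≡# (λ j → inBlock G S O l (d j))))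
                                                                        (sum-cong-≗ (λ i → count≡# (λ j → inOrbit G S O i (d j)))) ⟩
    ∑ (λ l → ∑ (B l)) + ∑ (λ i → ∑ (Z i))                  ≡⟨ cong₂ _+_ (∑-comm B) (∑-comm Z) ⟩
    ∑ (λ j → ∑ (λ l → B l j)) + ∑ (λ j → ∑ (λ i → Z i j))  ≡⟨ ∑-distrib-+ (λ j → ∑ (λ l → B l j)) _ ⟨
    ∑ (λ j → ∑ (λ l → B l j) + ∑ (λ i → Z i j))            ≡⟨ sum-cong-≗ (one-class ∘ d) ⟩
    ∑ {n} (λ _ → 1)                                        ≡⟨ trans (∑-const n 1) (*-identityʳ n) ⟩
    n                                                      ∎
    where
    open ≡-Reasoning
    B : Fin n → Fin n → ℕ
    B l j = 𝟙 (inBlock G S O l (d j))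
    Z : Fin k → Fin n → ℕ
    Z i j = 𝟙 (inOrbit G S O i (d j))

  πn-partition : ∀ {n} (d : Raw G S n) → IsLabeledPartition n k (πn G S O d)
  πn-partition {n} d = sortDesc-descending sizes , All-resp-↭ (↭-sym (sortDesc-↭ sizes)) (nonzeros-positive L) , total
    where
    L     = map (blockSize G S O d) (allFin n)
    sizes = nonzeros L
    total : sum (sortDesc sizes) + sum (map (orbitSize d) (allFin k)) ≡ n
    total = begin
      sum (sortDesc sizes) + sum (map (orbitSize d) (allFin k))
        ≡⟨ cong₂ _+_ (trans (sum-↭ (sortDesc-↭ sizes)) (trans (sum-nonzeros L) (sum-allFin (blockSize G S O d))))
                     (sum-allFin (orbitSize d)) ⟩
      ∑ (blockSize G S O d) + ∑ (orbitSize d)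
        ≡⟨ total-size d ⟩
      n ∎
      where open ≡-Reasoning

  blockSizeAt : ∀ {n} → Raw G S n → Entry G S n → ℕ
  blockSizeAt d (inj₁ (l , _)) = blockSize G S O d l
  blockSizeAt d (inj₂ _)       = 0

  block-census : ∀ {n} (d : Raw G S n) m →
                 suc m * fibre (blockSize G S O d) (suc m) ≡ # (λ j → does (blockSizeAt d (d j) ≟ suc m))
  block-census d m = trans (double-count (λ l j → inBlock G S O l (d j)) (suc m)) (sum-cong-≗ (in-block-of-size ∘ d))
    where
    E = λ l → 𝟙 (does (blockSize G S O d l ≟ suc m))
    in-block-of-size : ∀ e → ∑ (λ l → E l * 𝟙 (inBlock G S O l e)) ≡ 𝟙 (does (blockSizeAt d e ≟ suc m))
    in-block-of-size (inj₁ (l₀ , _)) = ∑-δ l₀ E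
    in-block-of-size (inj₂ _)        = ∑-vanishing _ (λ l → *-zeroʳ (E l))

  BlockMates : ∀ {n} → Entry G S n → Entry G S n → Set
  BlockMates e e′ = Σ _ λ l → blockOf G S e ≡ just l × blockOf G S e′ ≡ just l

  inBlock⇔mates : ∀ {n} {l : Fin n} {e} → blockOf G S e ≡ just l →
                  ∀ e′ → inBlock G S O l e′ ≡ true ⇔ BlockMates e e′
  inBlock⇔mates {l = l} e∈l (inj₁ (l′ , _)) = mk⇔
    (λ l≟l′ → l , e∈l , cong just (sym (witness (l Fin.≟ l′) l≟l′)))
    (λ { (_ , e∈l₂ , refl) → dec-true (l Fin.≟ l′) (just-injective (trans (sym e∈l) e∈l₂)) })
  inBlock⇔mates e∈l (inj₂ _) = mk⇔ (λ ()) (λ { (_ , _ , ()) })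

  blockSizeAt-≈D : ∀ {n} {d d′ : Raw G S n} → _≈D_ G S d d′ → ∀ j → blockSizeAt d (d j) ≡ blockSizeAt d′ (d′ j)
  blockSizeAt-≈D {d = d} {d′} d≈d′ j with d j in dj | d′ j in d′j | _≈D_.sameZero d≈d′ j
  ... | inj₁ (l , _) | inj₁ (l′ , _) | _ = count-cong (λ j′ → ⇔→≡ (same-members j′))
    where
    same-members : ∀ j′ → inBlock G S O l (d j′) ≡ true ⇔ inBlock G S O l′ (d′ j′) ≡ true
    same-members j′ = ⇔-trans (inBlock⇔mates (cong (blockOf G S) dj) (d j′))
      (⇔-trans (mk⇔ (proj₁ (_≈D_.sameBlocks d≈d′ j j′)) (proj₂ (_≈D_.sameBlocks d≈d′ j j′)))
               (⇔-sym (inBlock⇔mates (cong (blockOf G S) d′j) (d′ j′))))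
  ... | inj₂ _ | inj₂ _ | _ = refl

  inOrbit-zeroOf : ∀ {n} i (e e′ : Entry G S n) → zeroOf G S e ≡ zeroOf G S e′ → inOrbit G S O i e ≡ inOrbit G S O i e′
  inOrbit-zeroOf i (inj₁ _) (inj₁ _)  _    = refl
  inOrbit-zeroOf i (inj₂ x) (inj₂ .x) refl = refl

  πn-respects-≈D : ∀ {n} (d d′ : Raw G S n) → _≈D_ G S d d′ → πn G S O d ≈LP πn G S O d′
  πn-respects-≈D d d′ d≈d′ =
    shape-cong {f = blockSize G S O d} {g = blockSize G S O d′} same-sizes ,
    λ i → count-cong (λ j → inOrbit-zeroOf i (d j) (d′ j) (_≈D_.sameZero d≈d′ j))
    where
    same-sizes : ∀ m → fibre (blockSize G S O d) (suc m) ≡ fibre (blockSize G S O d′) (suc m)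
    same-sizes m = *-cancelˡ-≡ _ _ (suc m) (begin
      suc m * fibre (blockSize G S O d) (suc m)      ≡⟨ block-census d m ⟩
      # (λ j → does (blockSizeAt d (d j) ≟ suc m))
        ≡⟨ sum-cong-≗ (λ j → cong (λ s → 𝟙 (does (s ≟ suc m))) (blockSizeAt-≈D d≈d′ j)) ⟩
      # (λ j → does (blockSizeAt d′ (d′ j) ≟ suc m)) ≡⟨ block-census d′ m ⟨
      suc m * fibre (blockSize G S O d′) (suc m)     ∎)
      where open ≡-Reasoning

  -- A Σₙ[G]-translate of d consists of the entries of d, moved by the group and
  -- permuted, so counting an action-invariant property of entries gives the same number.
  count-actW : ∀ {n} (w : Wreath G S n) (d : Raw G S n) (P : Entry G S n → Bool) →
               (∀ g e → P (actEntry G S g e) ≡ P e) →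
               count (λ j → P (actW G S w d j)) ≡ count (λ j → P (d j))
  count-actW (wr gs σ) d P invariant = begin
    count (λ j → P (actW G S (wr gs σ) d j)) ≡⟨ count-cong (λ j → invariant (gs (σ ⟨$⟩ˡ j)) (d (σ ⟨$⟩ˡ j))) ⟩
    count (λ j → P (d (σ ⟨$⟩ˡ j)))           ≡⟨ count≡# (λ j → P (d (σ ⟨$⟩ˡ j))) ⟩
    # (λ j → P (d (σ ⟨$⟩ˡ j)))               ≡⟨ #-permute σ (P ∘ d) ⟩
    # (P ∘ d)                                ≡⟨ count≡# (P ∘ d) ⟨
    count (P ∘ d)                            ∎
    where open ≡-Reasoning

  inBlock-act : ∀ {n} (l : Fin n) g e → inBlock G S O l (actEntry G S g e) ≡ inBlock G S O l e
  inBlock-act l g (inj₁ _) = refl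
  inBlock-act l g (inj₂ _) = refl

  inOrbit-act : ∀ {n} i g (e : Entry G S n) → inOrbit G S O i (actEntry G S g e) ≡ inOrbit G S O i e
  inOrbit-act i g (inj₁ _) = refl
  inOrbit-act i g (inj₂ x) = cong (λ o → does (o Fin.≟ i)) (sym (orb-complete x (act g x) g refl))

  πn-invariant : ∀ {n} (w : Wreath G S n) (d : Raw G S n) → πn G S O (actW G S w d) ≈LP πn G S O d
  πn-invariant w d =
    cong (sortDesc ∘ nonzeros) (map-cong (λ l → count-actW w d (inBlock G S O l) (inBlock-act l)) (allFin _)) ,
    λ i → count-actW w d (inOrbit G S O i) (inOrbit-act i)

  representative : Fin k → Point
  representative i = proj₁ (orb-sur i)

  entryOf : ∀ {n} → Fin n ⊎ Fin k → Entry G S n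
  entryOf (inj₁ l) = inj₁ (l , ε)
  entryOf (inj₂ i) = inj₂ (representative i)

  -- Any block sizes b and orbit sizes z with total n occur for some raw datum:
  -- realise the multiplicities b, z by keys of the n points and take their entries.
  construct : ∀ {n} (b : Fin n → ℕ) (z : Fin k → ℕ) → ∑ b + ∑ z ≡ n →
              Σ (Raw G S n) λ d → (∀ l → blockSize G S O d l ≡ b l) × (∀ i → orbitSize d i ≡ z i)
  construct {n} b z total = d , block-sizes , orbit-sizes
    where
    bz = Sum.[ b , z ]′
    realised = realise (bz ∘ splitAt n) (trans (∑-splitAt n bz) total)
    d : Raw G S n
    d = entryOf ∘ splitAt n ∘ proj₁ realised
    census : ∀ (u : Entry G S n → ℕ) →
             ∑ (u ∘ d) ≡ ∑ (λ l → b l * u (entryOf (inj₁ l))) + ∑ (λ i → z i * u (entryOf (inj₂ i)))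
    census u = trans (proj₂ realised (u ∘ entryOf ∘ splitAt n)) (∑-splitAt n (λ s → bz s * u (entryOf s)))
    block-sizes : ∀ l → blockSize G S O d l ≡ b l
    block-sizes l₀ = begin
      blockSize G S O d l₀                        ≡⟨ count≡# (λ j → inBlock G S O l₀ (d j)) ⟩
      ∑ (λ j → 𝟙 (inBlock G S O l₀ (d j)))        ≡⟨ census (λ e → 𝟙 (inBlock G S O l₀ e)) ⟩
      ∑ (λ l → b l * δ l₀ l) + ∑ (λ i → z i * 0)  ≡⟨ cong₂ _+_ (sum-cong-≗ (λ l → cong (b l *_) (δ-sym l₀ l)))
                                                               (∑-vanishing _ (λ i → *-zeroʳ (z i))) ⟩
      ∑ (λ l → b l * δ l l₀) + 0                  ≡⟨ trans (+-identityʳ _) (∑-δ l₀ b) ⟩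
      b l₀                                        ∎
      where open ≡-Reasoning
    orbit-sizes : ∀ i → orbitSize d i ≡ z i
    orbit-sizes i₀ = begin
      orbitSize d i₀                              ≡⟨ count≡# (λ j → inOrbit G S O i₀ (d j)) ⟩
      ∑ (λ j → 𝟙 (inOrbit G S O i₀ (d j)))        ≡⟨ census (λ e → 𝟙 (inOrbit G S O i₀ e)) ⟩
      ∑ (λ l → b l * 0) + ∑ (λ i → z i * δ (orb (representative i)) i₀)
        ≡⟨ cong₂ _+_ (∑-vanishing _ (λ l → *-zeroʳ (b l)))
                     (sum-cong-≗ (λ i → cong (λ o → z i * δ o i₀) (proj₂ (orb-sur i)))) ⟩
      0 + ∑ (λ i → z i * δ i i₀)                  ≡⟨ ∑-δ i₀ z ⟩
      z i₀                                        ∎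
      where open ≡-Reasoning

  -- πn is surjective: use the parts as the sizes of the first blocks.
  πn-surjective : ∀ {n} (p : LPRaw k) → IsLabeledPartition n k p → ∃ λ (d : Raw G S n) → πn G S O d ≈LP p
  πn-surjective {n} (parts , lab) (descending , positive , total) = d , blocks , proj₂ (proj₂ built)
    where
    β : Fin n → ℕ
    β = listSizes parts
    fits : length parts ≤ n
    fits = ≤-trans (length≤sum parts positive) (subst (sum parts ≤_) total (m≤m+n (sum parts) _))
    nonzero-sizes : nonzeros (map β (allFin n)) ≡ parts
    nonzero-sizes = trans (cong nonzeros (trans (map-tabulate id β) (tabulate-listSizes n parts fits)))
                          (nonzeros-padded parts (n ∸ length parts) positive)
    sum-sizes : ∑ β ≡ sum parts
    sum-sizes = trans (sym (sum-allFin β)) (trans (sym (sum-nonzeros (map β (allFin n)))) (cong sum nonzero-sizes))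
    built = construct β lab (trans (cong₂ _+_ sum-sizes (sym (sum-allFin lab))) total)
    d = proj₁ built
    blocks : shape (blockSize G S O d) ≡ parts
    blocks = begin
      sortDesc (nonzeros (map (blockSize G S O d) (allFin n)))
        ≡⟨ cong (sortDesc ∘ nonzeros) (map-cong (proj₁ (proj₂ built)) (allFin n)) ⟩
      sortDesc (nonzeros (map β (allFin n)))                   ≡⟨ cong sortDesc nonzero-sizes ⟩
      sortDesc parts                                           ≡⟨ sortDesc-id parts descending ⟩
      parts                                                    ∎
      where open ≡-Reasoning

  relabel : ∀ {n} → (Fin n → Fin n) → Entry G S n → Entry G S n
  relabel τ (inj₁ (l , c)) = inj₁ (τ l , c)
  relabel τ (inj₂ x)       = inj₂ x

  relabel-≈D : ∀ {n} (τ : Fin n → Fin n) → (∀ {a b} → τ a ≡ τ b → a ≡ b) →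
               ∀ {d d′ : Raw G S n} → (∀ j → d j ≡ relabel τ (d′ j)) → _≈D_ G S d d′
  relabel-≈D τ τ-injective {d} {d′} d≡τd′ = record
    { sameZero   = λ j → trans (cong (zeroOf G S) (d≡τd′ j)) (zero-part (d′ j))
    ; sameBlocks = λ i j → Equivalence.to (mates-in i j) , Equivalence.from (mates-in i j)
    ; sameColour = λ i j _ → trans (trivial-quotient i) (sym (trivial-quotient j))
    }
    where
    zero-part : ∀ e → zeroOf G S (relabel τ e) ≡ zeroOf G S e
    zero-part (inj₁ _) = refl
    zero-part (inj₂ _) = refl
    colour-part : ∀ e → colourOf G S (relabel τ e) ≡ colourOf G S e
    colour-part (inj₁ _) = refl
    colour-part (inj₂ _) = refl
    mates : ∀ e₁ e₂ → BlockMates (relabel τ e₁) (relabel τ e₂) ⇔ BlockMates e₁ e₂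
    mates (inj₁ (l₁ , _)) (inj₁ (l₂ , _)) = mk⇔
      (λ { (_ , refl , τl₂≡τl₁) → l₁ , refl , cong just (τ-injective (just-injective τl₂≡τl₁)) })
      (λ { (_ , refl , refl) → τ l₁ , refl , refl })
    mates (inj₁ _) (inj₂ _) = mk⇔ (λ { (_ , _ , ()) }) (λ { (_ , _ , ()) })
    mates (inj₂ _) _        = mk⇔ (λ { (_ , () , _) }) (λ { (_ , () , _) })
    mates-in : ∀ i j → SameBlock G S d i j ⇔ SameBlock G S d′ i j
    mates-in i j = subst₂ (λ e₁ e₂ → BlockMates e₁ e₂ ⇔ SameBlock G S d′ i j)
                          (sym (d≡τd′ i)) (sym (d≡τd′ j)) (mates (d′ i) (d′ j))
    -- corresponding points carry the same colour, so every quotient b⁻¹ b′ is trivial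
    trivial-quotient : ∀ i → ((colourOf G S (d i)) ⁻¹) ∙ colourOf G S (d′ i) ≡ ε
    trivial-quotient i =
      trans (cong (λ c → (c ⁻¹) ∙ colourOf G S (d′ i)) (trans (cong (colourOf G S) (d≡τd′ i)) (colour-part (d′ i))))
            (IsGroup.inverseˡ isGroup (colourOf G S (d′ i)))

  key : ∀ {n} → (Fin n → Fin n) → Entry G S n → Fin n ⊎ Fin k
  key φ (inj₁ (l , _)) = inj₁ (φ l)
  key φ (inj₂ x)       = inj₂ (orb x)

  _≟key_ : ∀ {n} → DecidableEquality (Fin n ⊎ Fin k)
  _≟key_ = ≡-dec Fin._≟_ Fin._≟_

  keyFibre : ∀ {n m} → (Fin m → Fin n ⊎ Fin k) → Fin n ⊎ Fin k → ℕ
  keyFibre = Fibres.fibre _≟key_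

  keyFibre-block : ∀ {n} (ρ : Permutation′ n) (d : Raw G S n) l →
                   keyFibre (key (ρ ⟨$⟩ʳ_) ∘ d) (inj₁ l) ≡ blockSize G S O d (ρ ⟨$⟩ˡ l)
  keyFibre-block ρ d l =
    trans (sum-cong-≗ (cong 𝟙 ∘ in-block ∘ d)) (sym (count≡# (λ j → inBlock G S O (ρ ⟨$⟩ˡ l) (d j))))
    where
    in-block : ∀ e → does (key (ρ ⟨$⟩ʳ_) e ≟key inj₁ l) ≡ inBlock G S O (ρ ⟨$⟩ˡ l) e
    in-block (inj₁ (l₀ , _)) = does-⇔ (mk⇔
      (λ ρl₀≡l → trans (cong (ρ ⟨$⟩ˡ_) (sym (inj₁-injective ρl₀≡l))) (Perm.inverseˡ ρ))
      (λ ρ⁻¹l≡l₀ → cong inj₁ (trans (cong (ρ ⟨$⟩ʳ_) (sym ρ⁻¹l≡l₀)) (Perm.inverseʳ ρ))))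
      (inj₁ (ρ ⟨$⟩ʳ l₀) ≟key inj₁ l) ((ρ ⟨$⟩ˡ l) Fin.≟ l₀)
    in-block (inj₂ _) = refl

  keyFibre-orbit : ∀ {n} (φ : Fin n → Fin n) (d : Raw G S n) i →
                   keyFibre (key φ ∘ d) (inj₂ i) ≡ orbitSize d i
  keyFibre-orbit φ d i = trans (sum-cong-≗ (cong 𝟙 ∘ over-orbit ∘ d)) (sym (count≡# (λ j → inOrbit G S O i (d j))))
    where
    over-orbit : ∀ e → does (key φ e ≟key inj₂ i) ≡ inOrbit G S O i e
    over-orbit (inj₁ _) = refl
    over-orbit (inj₂ _) = refl

  keys-equidistributed : ∀ {n} (d d′ : Raw G S n) (ρ : Permutation′ n) →
    (∀ l → blockSize G S O d′ (ρ ⟨$⟩ʳ l) ≡ blockSize G S O d l) → (∀ i → orbitSize d i ≡ orbitSize d′ i) →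
    ∀ a → keyFibre (key (ρ ⟨$⟩ʳ_) ∘ d) a ≡ keyFibre (key id ∘ d′) a
  keys-equidistributed d d′ ρ same-blocks same-orbits (inj₁ l) = begin
    keyFibre (key (ρ ⟨$⟩ʳ_) ∘ d) (inj₁ l)      ≡⟨ keyFibre-block ρ d l ⟩
    blockSize G S O d (ρ ⟨$⟩ˡ l)               ≡⟨ same-blocks (ρ ⟨$⟩ˡ l) ⟨
    blockSize G S O d′ (ρ ⟨$⟩ʳ (ρ ⟨$⟩ˡ l))     ≡⟨ cong (blockSize G S O d′) (Perm.inverseʳ ρ) ⟩
    blockSize G S O d′ l                       ≡⟨ keyFibre-block Perm.id d′ l ⟨
    keyFibre (key id ∘ d′) (inj₁ l)            ∎
    where open ≡-Reasoning
  keys-equidistributed d d′ ρ same-blocks same-orbits (inj₂ i) =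
    trans (keyFibre-orbit (ρ ⟨$⟩ʳ_) d i) (trans (same-orbits i) (sym (keyFibre-orbit id d′ i)))

  -- Entries with matching keys are related by a group element, up to relabelling
  -- their block along ρ⁻¹: adjust the colour, resp. move the point within its orbit.
  align : ∀ {n} (ρ : Permutation′ n) e e′ → key (ρ ⟨$⟩ʳ_) e ≡ key id e′ →
          Σ Carrier λ g → actEntry G S g e ≡ relabel (ρ ⟨$⟩ˡ_) e′
  align ρ (inj₁ (l , c)) (inj₁ (l′ , c′)) ρl≡l′ = c′ ∙ (c ⁻¹) , cong₂ (λ a b → inj₁ (a , b)) label colour
    where
    open IsGroup isGroup using (assoc; identityʳ; inverseˡ)
    label : l ≡ ρ ⟨$⟩ˡ l′
    label = trans (sym (Perm.inverseˡ ρ)) (cong (ρ ⟨$⟩ˡ_) (inj₁-injective ρl≡l′))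
    colour : (c′ ∙ (c ⁻¹)) ∙ c ≡ c′
    colour = trans (assoc c′ (c ⁻¹) c) (trans (cong (c′ ∙_) (inverseˡ c)) (identityʳ c′))
  align ρ (inj₂ x) (inj₂ x′) same-orbit =
    let g , gx≡x′ = orb-sound x x′ (inj₂-injective same-orbit) in g , cong inj₂ gx≡x′

  translate : ∀ {n} (d d′ : Raw G S n) (ρ σ : Permutation′ n) →
              (∀ j → key id (d′ (σ ⟨$⟩ʳ j)) ≡ key (ρ ⟨$⟩ʳ_) (d j)) →
              Σ (Fin n → Carrier) λ gs → ∀ j → actW G S (wr gs σ) d j ≡ relabel (ρ ⟨$⟩ˡ_) (d′ j)
  translate d d′ ρ σ σ-matches = gs , translated
    where
    aligned : ∀ j → Σ Carrier λ g → actEntry G S g (d j) ≡ relabel (ρ ⟨$⟩ˡ_) (d′ (σ ⟨$⟩ʳ j))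
    aligned j = align ρ (d j) (d′ (σ ⟨$⟩ʳ j)) (sym (σ-matches j))
    gs = λ j → proj₁ (aligned j)
    translated : ∀ j → actW G S (wr gs σ) d j ≡ relabel (ρ ⟨$⟩ˡ_) (d′ j)
    translated j = trans (proj₂ (aligned (σ ⟨$⟩ˡ j))) (cong (relabel (ρ ⟨$⟩ˡ_) ∘ d′) (Perm.inverseʳ σ))

  -- The fibres of πn are Σₙ[G]-orbits: relabel the blocks so that sizes match, match
  -- the points by their keys, and translate.
  πn-fibres-are-orbits : ∀ {n} (d d′ : Raw G S n) → πn G S O d ≈LP πn G S O d′ →
                         ∃ λ (w : Wreath G S n) → _≈D_ G S (actW G S w d) d′
  πn-fibres-are-orbits d d′ (same-shape , same-orbits) =
    let ρ , same-blocks = matching-ℕ (blockSize G S O d) (blockSize G S O d′)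
                                     (shape-fibres {f = blockSize G S O d} {g = blockSize G S O d′} same-shape)
        σ , σ-matches   = Fibres.matching _≟key_ (key (ρ ⟨$⟩ʳ_) ∘ d) (key id ∘ d′)
                                     (keys-equidistributed d d′ ρ same-blocks same-orbits)
        gs , translated = translate d d′ ρ σ σ-matches
        ρ⁻¹-injective   = λ {a b} (eq : ρ ⟨$⟩ˡ a ≡ ρ ⟨$⟩ˡ b) →
                            trans (sym (Perm.inverseʳ ρ)) (trans (cong (ρ ⟨$⟩ʳ_) eq) (Perm.inverseʳ ρ))
    in wr gs σ , relabel-≈D (ρ ⟨$⟩ˡ_) ρ⁻¹-injective translated

-- Theorem 2.25.
theorem2p25 : (G : FinGroup) (S : FinGSet G) (k : ℕ) (O : OrbitEnumeration S k)
    (n : ℕ) → n ≥ 1 →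
    (∀ (d : Raw G S n) → IsLabeledPartition n k (πn G S O d))
    × (∀ (d d′ : Raw G S n) → _≈D_ G S d d′ → πn G S O d ≈LP πn G S O d′)
    × (∀ (p : LPRaw k) → IsLabeledPartition n k p → ∃ λ (d : Raw G S n) → πn G S O d ≈LP p)
    × (∀ (w : Wreath G S n) (d : Raw G S n) → πn G S O (actW G S w d) ≈LP πn G S O d)
    × (∀ (d d′ : Raw G S n) → πn G S O d ≈LP πn G S O d′ →
         ∃ λ (w : Wreath G S n) → _≈D_ G S (actW G S w d) d′)
theorem2p25 G S k O n _ =
  πn-partition G S O ,
  πn-respects-≈D G S O ,
  πn-surjective G S O ,
  πn-invariant G S O ,
  πn-fibres-are-orbits G S O
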